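{- Let $H \subseteq F^7$ be the binary Hamming code of length 7 spanned by the vectors with supports $\{1,2,3\}$, $\{1,4,5\}$, $\{1,6,7\}$, $\{2,4,6\}$. Let $\lambda_1 : H \to\{0,1\}$ be $0$ exactly on the codewords with supports $\emptyset$, $\{1,6,7\}$, $\{1,3,5,7\}$, $\{1,\dots,7\}$ and $1$ elsewhere; let $\lambda_2 : H\to\{0,1\}$ be $0$ exactly on the codewords with supports $\emptyset$, $\{1,6,7\}$, $\{2,4,6\}$, $\{4,5,6,7\}$ and $1$ elsewhere. Then the Vasil'ev codes $V_H^{\lambda_1}$ (denoted $V22^1$) and $V_H^{\lambda_2}$ (denoted $V3^11$) of length 15 are not transitive.
   Context: For $\lambda: H\to\{0,1\}$ with $\lambda(0)=0$, $V_H^\lambda = \{(x+y, |x|+\lambda(y), x) : x\in F^7, y\in H\}\subseteq F^{15}$, where $|x|=x_1+\dots+x_7 \bmod 2$. A code $D\subseteq F^m$ is transitive if for every $w\in D$ there is a coordinate permutation $\pi\in S_m$ with $w + \pi(D) = D$. -}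

module Defs where

open import Data.Bool using (Bool; true; false; _xor_; _∧_; if_then_else_)
open import Data.Nat using (ℕ)
open import Data.Fin using (Fin)
open import Data.Vec using (Vec; []; _∷_; _++_; zipWith; map; foldr; lookup; tabulate)
open import Data.Vec.Properties using (≡-dec)
open import Data.Product using (Σ; ∃; _×_; _,_)
open import Data.List using (List; []; _∷_)
open import Data.List.Relation.Unary.Any using (any?)
open import Relation.Nullary.Decidable using (does)
open import Relation.Binary.PropositionalEquality using (_≡_)
open import Function.Bundles using (_⇔_)
open import Data.Fin.Permutation using (Permutation′; _⟨$⟩ˡ_)
import Data.Bool as B

-- binary words of length m (F = Bool, addition = xor)
Word : ℕ → Set
Word m = Vec Bool m

Code : ℕ → Set₁
Code m = Word m → Set

_⊕_ : ∀ {m} → Word m → Word m → Word m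
_⊕_ = zipWith _xor_

wt2 : ∀ {m} → Word m → Bool
wt2 = foldr _ _xor_ false

scale : ∀ {m} → Bool → Word m → Word m
scale c = map (c ∧_)

g₁ g₂ g₃ g₄ : Word 7
g₁ = true ∷ true ∷ true ∷ false ∷ false ∷ false ∷ false ∷ []
g₂ = true ∷ false ∷ false ∷ true ∷ true ∷ false ∷ false ∷ []
g₃ = true ∷ false ∷ false ∷ false ∷ false ∷ true ∷ true ∷ []
g₄ = false ∷ true ∷ false ∷ true ∷ false ∷ true ∷ false ∷ []

H : Code 7
H y = Σ Bool λ c₁ → Σ Bool λ c₂ → Σ Bool λ c₃ → Σ Bool λ c₄ →
      y ≡ scale c₁ g₁ ⊕ (scale c₂ g₂ ⊕ (scale c₃ g₃ ⊕ scale c₄ g₄))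

-- Vasil'ev code V_H^λ = {(x+y, |x|+λ(y), x) : x ∈ F^7, y ∈ H} ⊆ F^15
-- (λ is only ever evaluated on elements of H)
Vasilev : (Word 7 → Set) → (Word 7 → Bool) → Code 15
Vasilev Hc λf v = Σ (Word 7) λ x → Σ (Word 7) λ y →
  Hc y × (v ≡ (x ⊕ y) ++ ((wt2 x xor λf y) ∷ x))

-- image of a word under a coordinate permutation: π(v)_{π(i)} = v_i
permute : ∀ {m} → Permutation′ m → Word m → Word m
permute π v = tabulate λ i → lookup v (π ⟨$⟩ˡ i)

Transitive : ∀ {m} → Code m → Set
Transitive {m} D = ∀ w → D w → ∃ λ (π : Permutation′ m) →
  ∀ u → (D u ⇔ (∃ λ d → D d × u ≡ w ⊕ permute π d))

inList : ∀ {m} → Word m → List (Word m) → Bool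
inList w ws = does (any? (λ v → ≡-dec B._≟_ w v) ws)

s∅ s167 s1357 s1234567 s246 s4567 : Word 7
s∅       = false ∷ false ∷ false ∷ false ∷ false ∷ false ∷ false ∷ []
s167     = true ∷ false ∷ false ∷ false ∷ false ∷ true ∷ true ∷ []
s1357    = true ∷ false ∷ true ∷ false ∷ true ∷ false ∷ true ∷ []
s1234567 = true ∷ true ∷ true ∷ true ∷ true ∷ true ∷ true ∷ []
s246     = false ∷ true ∷ false ∷ true ∷ false ∷ true ∷ false ∷ []
s4567    = false ∷ false ∷ false ∷ true ∷ true ∷ true ∷ true ∷ []

λ₁ : Word 7 → Bool
λ₁ y = if inList y (s∅ ∷ s167 ∷ s1357 ∷ s1234567 ∷ []) then false else true

λ₂ : Word 7 → Bool
λ₂ y = if inList y (s∅ ∷ s167 ∷ s246 ∷ s4567 ∷ []) then false else true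

V22¹ V3¹1 : Code 15
V22¹ = Vasilev H λ₁
V3¹1 = Vasilev H λ₂

module Submission where

-- If D is transitive and w ∈ D, some coordinate permutation π has
-- w + π(D) = D, so the translate w + D is the image π(D).  Permutations
-- preserve sums and weights of words, hence every permutation-invariant
-- configuration of w + D already occurs in D.  The configuration used is
-- the pattern of a triple a, b, c of weight-3 words: the weights of the
-- sums a+b, a+c, b+c, a+b+c and whether each sum lies in the code.  For
-- each code we exhibit a codeword w and three weight-3 words of w + D whose
-- pattern no triple of weight-3 codewords of D has.  That last fact is
-- checked by evaluation over the 35 weight-3 codewords, which are
-- enumerated (not listed by hand) from the definition of the code.

open import Defs
open import Data.Bool using (Bool; true; false; _xor_; if_then_else_)
import Data.Bool.Properties as Bool
open import Data.Bool.ListAction using (any)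
open import Data.Nat using (ℕ; zero; suc; _+_; _≡ᵇ_)
import Data.Nat.Properties as ℕ
open import Data.Nat.Properties using (+-0-commutativeMonoid)
open import Algebra.Properties.CommutativeMonoid.Sum +-0-commutativeMonoid
  using (sum; sum-permute; sum-cong-≗)
open import Data.Fin using (toℕ)
open import Data.Fin.Permutation as Perm using (Permutation′; _⟨$⟩ˡ_; _⟨$⟩ʳ_)
open import Data.Vec using (Vec; []; _∷_; _++_; zipWith; map; lookup; tabulate; splitAt)
open import Data.Vec.Properties
  using (lookup∘tabulate; tabulate∘lookup; tabulate-cong; lookup-zipWith; ++-injective; ∷-injective; map-∘; map-cong)
import Data.Vec.Properties as Vec
import Data.Product.Properties as Product
open import Data.Product using (∃; _×_; _,_)
open import Data.List as List using (List; []; _∷_; filter; cartesianProductWith)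
open import Data.List.Membership.Propositional using (_∈_)
open import Data.List.Membership.Propositional.Properties
  using (∈-map⁺; ∈-++⁺ˡ; ∈-++⁺ʳ; ∈-filter⁺; ∈-cartesianProductWith⁺)
open import Data.List.Relation.Unary.All as All using (All; all?)
open import Data.List.Relation.Unary.Any using (here)
open import Function.Bundles using (_⇔_; mk⇔; Equivalence)
open import Relation.Nullary using (¬_; Dec; does; ¬?; _×-dec_)
open import Relation.Nullary.Decidable using (map′; does-⇔; True; toWitness)
import Relation.Nullary.Decidable as Dec
open import Relation.Unary using (Decidable)
open import Relation.Binary.PropositionalEquality

⊕-cancelˡ : ∀ {m} (w a : Word m) → w ⊕ (w ⊕ a) ≡ a
⊕-cancelˡ []          []      = refl
⊕-cancelˡ (true  ∷ w) (b ∷ a) = cong₂ _∷_ (Bool.not-involutive b) (⊕-cancelˡ w a)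
⊕-cancelˡ (false ∷ w) (b ∷ a) = cong (b ∷_) (⊕-cancelˡ w a)

⊕-injectiveˡ : ∀ {m} (w : Word m) {a b : Word m} → w ⊕ a ≡ w ⊕ b → a ≡ b
⊕-injectiveˡ w {a} {b} eq = begin
  a            ≡⟨ ⊕-cancelˡ w a ⟨
  w ⊕ (w ⊕ a)  ≡⟨ cong (w ⊕_) eq ⟩
  w ⊕ (w ⊕ b)  ≡⟨ ⊕-cancelˡ w b ⟩
  b            ∎
  where open ≡-Reasoning

_≟ʷ_ : ∀ {m} (a b : Word m) → Dec (a ≡ b)
_≟ʷ_ = Vec.≡-dec Bool._≟_

lookup-extensionality : ∀ {m} {a b : Word m} → (∀ i → lookup a i ≡ lookup b i) → a ≡ b
lookup-extensionality {a = a} {b} agree =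
  trans (sym (tabulate∘lookup a)) (trans (tabulate-cong agree) (tabulate∘lookup b))

bit : Bool → ℕ
bit b = if b then 1 else 0

weight : ∀ {m} → Word m → ℕ
weight []      = 0
weight (b ∷ v) = bit b + weight v

-- the weight as a sum over the coordinates, the form in which it can be reindexed
weight-sum : ∀ {m} (v : Word m) → weight v ≡ sum (λ i → bit (lookup v i))
weight-sum []      = refl
weight-sum (b ∷ v) = cong (bit b +_) (weight-sum v)

-- For weight-3 words these weights determine the intersection
-- sizes |a∩b|, |a∩c|, |b∩c| and |a∩b∩c|.
sums : ∀ {m} → Word m → Word m → Word m → Vec (Word m) 4
sums a b c = a ⊕ b ∷ a ⊕ c ∷ b ⊕ c ∷ (a ⊕ b) ⊕ c ∷ []

Pattern : Set
Pattern = Vec (ℕ × Bool) 4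

triplePattern : ∀ {m} → (Word m → Bool) → Word m → Word m → Word m → Pattern
triplePattern member a b c = map (λ v → weight v , member v) (sums a b c)

_≟ᵖ_ : (p q : Pattern) → Dec (p ≡ q)
_≟ᵖ_ = Vec.≡-dec (Product.≡-dec ℕ._≟_ Bool._≟_)

module _ {m : ℕ} (π : Permutation′ m) where

  lookup-permute : ∀ v i → lookup (permute π v) i ≡ lookup v (π ⟨$⟩ˡ i)
  lookup-permute v i = lookup∘tabulate _ i

  permute-zipWith : ∀ (f : Bool → Bool → Bool) a b →
                    permute π (zipWith f a b) ≡ zipWith f (permute π a) (permute π b)
  permute-zipWith f a b = lookup-extensionality λ i → begin
    lookup (permute π (zipWith f a b)) i                 ≡⟨ lookup-permute (zipWith f a b) i ⟩
    lookup (zipWith f a b) (π ⟨$⟩ˡ i)                    ≡⟨ lookup-zipWith f (π ⟨$⟩ˡ i) a b ⟩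
    f (lookup a (π ⟨$⟩ˡ i)) (lookup b (π ⟨$⟩ˡ i))        ≡⟨ cong₂ f (lookup-permute a i) (lookup-permute b i) ⟨
    f (lookup (permute π a) i) (lookup (permute π b) i)  ≡⟨ lookup-zipWith f i (permute π a) (permute π b) ⟨
    lookup (zipWith f (permute π a) (permute π b)) i     ∎
    where open ≡-Reasoning

  permute-⊕ : ∀ a b → permute π (a ⊕ b) ≡ permute π a ⊕ permute π b
  permute-⊕ = permute-zipWith _xor_

  permute-injective : ∀ {a b} → permute π a ≡ permute π b → a ≡ b
  permute-injective {a} {b} eq = lookup-extensionality λ j → begin
    lookup a j                       ≡⟨ cong (lookup a) (Perm.inverseˡ π) ⟨
    lookup a (π ⟨$⟩ˡ (π ⟨$⟩ʳ j))     ≡⟨ lookup-permute a (π ⟨$⟩ʳ j) ⟨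
    lookup (permute π a) (π ⟨$⟩ʳ j)  ≡⟨ cong (λ v → lookup v (π ⟨$⟩ʳ j)) eq ⟩
    lookup (permute π b) (π ⟨$⟩ʳ j)  ≡⟨ lookup-permute b (π ⟨$⟩ʳ j) ⟩
    lookup b (π ⟨$⟩ˡ (π ⟨$⟩ʳ j))     ≡⟨ cong (lookup b) (Perm.inverseˡ π) ⟩
    lookup b j                       ∎
    where open ≡-Reasoning

  -- reindexing a finite sum along a bijection does not change it
  weight-permute : ∀ v → weight (permute π v) ≡ weight v
  weight-permute v = begin
    weight (permute π v)                      ≡⟨ weight-sum (permute π v) ⟩
    sum (λ i → bit (lookup (permute π v) i))  ≡⟨ sum-cong-≗ (λ i → cong bit (lookup-permute v i)) ⟩
    sum (λ i → bit (lookup v (π ⟨$⟩ˡ i)))     ≡⟨ sum-permute (λ i → bit (lookup v i)) (Perm.flip π) ⟨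
    sum (λ i → bit (lookup v i))              ≡⟨ weight-sum v ⟨
    weight v                                  ∎
    where open ≡-Reasoning

  sums-permute : ∀ a b c → sums (permute π a) (permute π b) (permute π c) ≡ map (permute π) (sums a b c)
  sums-permute a b c = sym (cong₂ _∷_ (permute-⊕ a b) (cong₂ _∷_ (permute-⊕ a c) (cong₂ _∷_ (permute-⊕ b c)
    (cong (_∷ []) (trans (permute-⊕ (a ⊕ b) c) (cong (_⊕ permute π c) (permute-⊕ a b)))))))

  triplePattern-permute : ∀ (member member′ : Word m → Bool) → (∀ v → member′ (permute π v) ≡ member v) →
                          ∀ a b c → triplePattern member′ (permute π a) (permute π b) (permute π c)
                                    ≡ triplePattern member a b c
  triplePattern-permute member member′ transport a b c = begin
    map profile′ (sums (permute π a) (permute π b) (permute π c))  ≡⟨ cong (map profile′) (sums-permute a b c) ⟩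
    map profile′ (map (permute π) (sums a b c))                    ≡⟨ map-∘ profile′ (permute π) (sums a b c) ⟨
    map (λ v → profile′ (permute π v)) (sums a b c)                ≡⟨ map-cong profile-permute (sums a b c) ⟩
    map profile (sums a b c)                                       ∎
    where
    open ≡-Reasoning
    profile profile′ : Word m → ℕ × Bool
    profile  v = weight v , member v
    profile′ v = weight v , member′ v
    profile-permute : ∀ v → profile′ (permute π v) ≡ profile v
    profile-permute v = cong₂ _,_ (weight-permute v) (transport v)

module _ {m : ℕ} (D : Code m) (w : Word m) (π : Permutation′ m)
         (w+πD≡D : ∀ u → D u ⇔ (∃ λ d → D d × u ≡ w ⊕ permute π d)) where

  translate-invariant : ∀ a → D (w ⊕ permute π a) ⇔ D a
  translate-invariant a = mk⇔ back (λ Da → Equivalence.from (w+πD≡D _) (a , Da , refl))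
    where
    back : D (w ⊕ permute π a) → D a
    back Dwπa with Equivalence.to (w+πD≡D _) Dwπa
    ... | d , Dd , eq = subst D (sym (permute-injective π (⊕-injectiveˡ w eq))) Dd

  translate-preimage : ∀ {s} → D (w ⊕ s) → ∃ λ d → D d × s ≡ permute π d
  translate-preimage Dws with Equivalence.to (w+πD≡D _) Dws
  ... | d , Dd , eq = d , Dd , ⊕-injectiveˡ w eq

module Criterion {m : ℕ} {D : Code m} (D? : Decidable D) where

  member : Word m → Bool
  member v = does (D? v)

  InTranslate : Word m → ℕ → Word m → Set
  InTranslate w k s = D (w ⊕ s) × weight s ≡ k

  Unrealised : List (Word m) → Pattern → Set
  Unrealised L p = All (λ a → All (λ b → All (λ c → triplePattern member a b c ≢ p) L) L) L

  unrealised? : ∀ L p → Dec (Unrealised L p)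
  unrealised? L p = all? (λ a → all? (λ b → all? (λ c → ¬? (triplePattern member a b c ≟ᵖ p)) L) L) L

  not-transitive : ∀ (k : ℕ) (L : List (Word m)) → (∀ t → D t → weight t ≡ k → t ∈ L) →
                   ∀ w s₁ s₂ s₃ → D w →
                   InTranslate w k s₁ → InTranslate w k s₂ → InTranslate w k s₃ →
                   Unrealised L (triplePattern (λ v → member (w ⊕ v)) s₁ s₂ s₃) →
                   ¬ Transitive D
  not-transitive k L complete w s₁ s₂ s₃ Dw s₁∈ s₂∈ s₃∈ unrealised transitive
    with transitive w Dw
  ... | π , w+πD≡D with preimage s₁∈ | preimage s₂∈ | preimage s₃∈
    where
    -- the preimage of a weight-k word of w + D is a weight-k codeword, so it lies in L
    preimage : ∀ {s} → InTranslate w k s → ∃ λ d → d ∈ L × s ≡ permute π d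
    preimage (Dws , ∣s∣≡k) with translate-preimage D w π w+πD≡D Dws
    ... | d , Dd , refl = d , complete d Dd (trans (sym (weight-permute π d)) ∣s∣≡k) , refl
  ... | d₁ , d₁∈L , refl | d₂ , d₂∈L , refl | d₃ , d₃∈L , refl =
    All.lookup (All.lookup (All.lookup unrealised d₁∈L) d₂∈L) d₃∈L
      (sym (triplePattern-permute π member (λ v → member (w ⊕ v)) member-transported d₁ d₂ d₃))
    where
    member-transported : ∀ a → member (w ⊕ permute π a) ≡ member a
    member-transported a = does-⇔ (translate-invariant D w π w+πD≡D a) (D? _) (D? a)

allWords : ∀ n → List (Word n)
allWords zero    = [] ∷ []
allWords (suc n) = List.map (true ∷_) (allWords n) List.++ List.map (false ∷_) (allWords n)

∈-allWords : ∀ {n} (v : Word n) → v ∈ allWords n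
∈-allWords []          = here refl
∈-allWords (true  ∷ v) = ∈-++⁺ˡ (∈-map⁺ (true ∷_) (∈-allWords v))
∈-allWords (false ∷ v) = ∈-++⁺ʳ _ (∈-map⁺ (false ∷_) (∈-allWords v))

∀-word : ∀ {n} {P : Word n → Set} (P? : Decidable P) → True (all? P? (allWords n)) → ∀ v → P v
∀-word P? checked v = All.lookup (toWitness checked) (∈-allWords v)

weightClass : ∀ {m} → ℕ → List (Word m) → List (Word m)
weightClass k = filter (λ t → weight t ℕ.≟ k)

∈-weightClass : ∀ {m} {k} {ws : List (Word m)} {t} → t ∈ ws → weight t ≡ k → t ∈ weightClass k ws
∈-weightClass {k = k} = ∈-filter⁺ (λ t → weight t ℕ.≟ k)

hammingWord : Word 4 → Word 7
hammingWord (c₁ ∷ c₂ ∷ c₃ ∷ c₄ ∷ []) = scale c₁ g₁ ⊕ (scale c₂ g₂ ⊕ (scale c₃ g₃ ⊕ scale c₄ g₄))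

hammingWords : List (Word 7)
hammingWords = List.map hammingWord (allWords 4)

∈-hammingWords : ∀ y → H y → y ∈ hammingWords
∈-hammingWords _ (c₁ , c₂ , c₃ , c₄ , refl) = ∈-map⁺ hammingWord (∈-allWords (c₁ ∷ c₂ ∷ c₃ ∷ c₄ ∷ []))

-- Coordinates 3, 5, 7 and 2 + 3 recover the coefficients of a codeword: g₁,
-- g₂, g₃ are the only generators meeting coordinates 3, 5, 7 respectively,
-- and coordinate 2 meets exactly g₁ and g₄.
hammingCoefficients : Word 7 → Word 4
hammingCoefficients (_ ∷ y₂ ∷ y₃ ∷ _ ∷ y₅ ∷ _ ∷ y₇ ∷ []) = y₃ ∷ y₅ ∷ y₇ ∷ (y₂ xor y₃) ∷ []

hammingCoefficients-hammingWord : ∀ c → hammingCoefficients (hammingWord c) ≡ c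
hammingCoefficients-hammingWord = ∀-word (λ c → hammingCoefficients (hammingWord c) ≟ʷ c) _

H-by-coefficients : ∀ y → (y ≡ hammingWord (hammingCoefficients y)) ⇔ H y
H-by-coefficients y = mk⇔ (inH (hammingCoefficients y)) fixed
  where
  inH : ∀ c → y ≡ hammingWord c → H y
  inH (c₁ ∷ c₂ ∷ c₃ ∷ c₄ ∷ []) eq = c₁ , c₂ , c₃ , c₄ , eq
  fixed : H y → y ≡ hammingWord (hammingCoefficients y)
  fixed (c₁ , c₂ , c₃ , c₄ , refl) = cong hammingWord (sym (hammingCoefficients-hammingWord (c₁ ∷ c₂ ∷ c₃ ∷ c₄ ∷ [])))

H? : Decidable H
H? y = Dec.map (H-by-coefficients y) (y ≟ʷ hammingWord (hammingCoefficients y))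

vasilevWord : (Word 7 → Bool) → Word 7 → Word 7 → Word 15
vasilevWord λf x y = (x ⊕ y) ++ ((wt2 x xor λf y) ∷ x)

vasilevWords : (Word 7 → Bool) → List (Word 7) → List (Word 15)
vasilevWords λf = cartesianProductWith (vasilevWord λf) (allWords 7)

∈-vasilevWords : ∀ {C : Word 7 → Set} λf {ys} → (∀ y → C y → y ∈ ys) →
                 ∀ v → Vasilev C λf v → v ∈ vasilevWords λf ys
∈-vasilevWords λf complete _ (x , y , Cy , refl) =
  ∈-cartesianProductWith⁺ (vasilevWord λf) (∈-allWords x) (complete y Cy)

-- Membership is decidable: a word (a, b, x) is a codeword iff y = x + a lies
-- in C and the middle bit is b = |x| + λ(y).
vasilev? : ∀ {C : Word 7 → Set} → Decidable C → ∀ λf → Decidable (Vasilev C λf)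
vasilev? {C} C? λf v with splitAt 7 v
... | a , b ∷ x , refl = map′ encode decode (C? (x ⊕ a) ×-dec (b Bool.≟ wt2 x xor λf (x ⊕ a)))
  where
  encode : C (x ⊕ a) × b ≡ wt2 x xor λf (x ⊕ a) → Vasilev C λf (a ++ (b ∷ x))
  encode (Cy , b≡) = x , x ⊕ a , Cy , cong₂ (λ a′ b′ → a′ ++ (b′ ∷ x)) (sym (⊕-cancelˡ x a)) b≡

  decode : Vasilev C λf (a ++ (b ∷ x)) → C (x ⊕ a) × b ≡ wt2 x xor λf (x ⊕ a)
  decode (x′ , y , Cy , eq) with ++-injective a (x′ ⊕ y) eq
  ... | refl , tail≡ with ∷-injective tail≡
  ... | refl , refl rewrite ⊕-cancelˡ x′ y = Cy , refl

module VasilevOverH (λf : Word 7 → Bool) where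

  V : Code 15
  V = Vasilev H λf

  V? : Decidable V
  V? = vasilev? H? λf

  open Criterion V?

  weight3 : List (Word 15)
  weight3 = weightClass 3 (vasilevWords λf hammingWords)

  ∈-weight3 : ∀ t → V t → weight t ≡ 3 → t ∈ weight3
  ∈-weight3 t Vt ∣t∣≡3 = ∈-weightClass (∈-vasilevWords λf ∈-hammingWords t Vt) ∣t∣≡3

  Certificate : Word 15 → Word 15 → Word 15 → Word 15 → Set
  Certificate w s₁ s₂ s₃ = V w × (InTranslate w 3 s₁ × InTranslate w 3 s₂ × InTranslate w 3 s₃)
                           × Unrealised weight3 (triplePattern (λ v → member (w ⊕ v)) s₁ s₂ s₃)

  certificate? : ∀ w s₁ s₂ s₃ → Dec (Certificate w s₁ s₂ s₃)
  certificate? w s₁ s₂ s₃ = V? w ×-dec ((inTranslate? s₁ ×-dec (inTranslate? s₂ ×-dec inTranslate? s₃))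
                            ×-dec unrealised? weight3 (triplePattern (λ v → member (w ⊕ v)) s₁ s₂ s₃))
    where
    inTranslate? : ∀ s → Dec (InTranslate w 3 s)
    inTranslate? s = V? (w ⊕ s) ×-dec (weight s ℕ.≟ 3)

  not-transitive-by-certificate : ∀ w s₁ s₂ s₃ → True (certificate? w s₁ s₂ s₃) → ¬ Transitive V
  not-transitive-by-certificate w s₁ s₂ s₃ checked =
    let Vw , (s₁∈ , s₂∈ , s₃∈) , unrealised = toWitness checked
    in  not-transitive 3 weight3 ∈-weight3 w s₁ s₂ s₃ Vw s₁∈ s₂∈ s₃∈ unrealised

-- The word of length m with the given support, coordinates numbered from 1.
supportWord : ∀ {m} → List ℕ → Word m
supportWord S = tabulate λ i → any (λ j → suc (toℕ i) ≡ᵇ j) S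

-- For V22¹, from w = {11,12,15}: three pairwise disjoint words, with exactly
-- one of the three pairwise sums outside the translate.  For V3¹1, from
-- w = {11,13,14}: three words through coordinate 6, with all pairwise sums
-- but not the total sum in the translate.
mainTheorem8 : ¬ Transitive V22¹ × ¬ Transitive V3¹1
mainTheorem8 =
    VasilevOverH.not-transitive-by-certificate λ₁ (supportWord (11 ∷ 12 ∷ 15 ∷ []))
      (supportWord (1 ∷ 14 ∷ 15 ∷ [])) (supportWord (2 ∷ 5 ∷ 7 ∷ [])) (supportWord (6 ∷ 11 ∷ 13 ∷ [])) _
  , VasilevOverH.not-transitive-by-certificate λ₂ (supportWord (11 ∷ 13 ∷ 14 ∷ []))
      (supportWord (3 ∷ 6 ∷ 13 ∷ [])) (supportWord (1 ∷ 6 ∷ 7 ∷ [])) (supportWord (6 ∷ 10 ∷ 12 ∷ [])) _
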